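{- Let $n$ be a positive integer and $N$, $a_1$, $a_2$, $b_1$, $b_2$ integers such that $n = (N - a_1)(N + b_1) = (N - a_2)(N + b_2)$, with $0 \le a_1 < a_2$ and $0 \le b_1 < b_2$. Then $a_2 b_2 \ge N$. -}

module Defs where

module Submission where

-- Expanding both products, (N - a₁)(N + b₁) = (N - a₂)(N + b₂)
-- is equivalent to the linear relation
--     N · ((a₁ + b₂) - (a₂ + b₁)) = a₂b₂ - a₁b₁ .
-- Because 0 ≤ a₁ < a₂ and 0 ≤ b₁ < b₂, the gap a₂b₂ - a₁b₁ is positive,
-- and it is at most a₂b₂.  So it suffices to show N ≤ a₂b₂ - a₁b₁: this is
-- immediate if N ≤ 0, and if N > 0 the factor d = (a₁ + b₂) - (a₂ + b₁)
-- must be positive, hence d ≥ 1 and N ≤ N · d = a₂b₂ - a₁b₁.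

open import Defs
open import Data.Integer using (ℤ; +_; -_; _+_; _-_; _*_; _≤_; _<_; 0ℤ; 1ℤ; NonNegative; positive; nonNegative)
open import Data.Integer.Properties
open import Data.Integer.Solver using (module +-*-Solver)
open import Relation.Nullary using (yes; no)
open import Relation.Binary.PropositionalEquality using (_≡_; refl; sym; trans; cong; subst; module ≡-Reasoning)

equal-products⇒linear : (N a₁ a₂ b₁ b₂ : ℤ) →
  (N - a₁) * (N + b₁) ≡ (N - a₂) * (N + b₂) →
  N * ((a₁ + b₂) - (a₂ + b₁)) ≡ a₂ * b₂ - a₁ * b₁
equal-products⇒linear N a₁ a₂ b₁ b₂ same = begin
  N * ((a₁ + b₂) - (a₂ + b₁))
    ≡⟨ expand N a₁ a₂ b₁ b₂ ⟩
  (a₂ * b₂ - a₁ * b₁) + ((N - a₂) * (N + b₂) - (N - a₁) * (N + b₁))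
    ≡⟨ cong (λ x → (a₂ * b₂ - a₁ * b₁) + ((N - a₂) * (N + b₂) - x)) same ⟩
  (a₂ * b₂ - a₁ * b₁) + ((N - a₂) * (N + b₂) - (N - a₂) * (N + b₂))
    ≡⟨ cong (λ x → (a₂ * b₂ - a₁ * b₁) + x) (+-inverseʳ ((N - a₂) * (N + b₂))) ⟩
  (a₂ * b₂ - a₁ * b₁) + 0ℤ
    ≡⟨ +-identityʳ (a₂ * b₂ - a₁ * b₁) ⟩
  a₂ * b₂ - a₁ * b₁ ∎
  where
  open ≡-Reasoning
  open +-*-Solver
  expand : (N a₁ a₂ b₁ b₂ : ℤ) →
    N * ((a₁ + b₂) - (a₂ + b₁))
      ≡ (a₂ * b₂ - a₁ * b₁) + ((N - a₂) * (N + b₂) - (N - a₁) * (N + b₁))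
  expand = solve 5 (λ N a₁ a₂ b₁ b₂ →
    N :* ((a₁ :+ b₂) :- (a₂ :+ b₁))
      := (a₂ :* b₂ :- a₁ :* b₁) :+ ((N :- a₂) :* (N :+ b₂) :- (N :- a₁) :* (N :+ b₁))) refl

*-strictMono-nonNeg : {a₁ a₂ b₁ b₂ : ℤ} →
  0ℤ ≤ a₁ → a₁ < a₂ → 0ℤ ≤ b₁ → b₁ < b₂ → a₁ * b₁ < a₂ * b₂
*-strictMono-nonNeg {a₁} {a₂} {b₁} {b₂} 0≤a₁ a₁<a₂ 0≤b₁ b₁<b₂ = begin-strict
  a₁ * b₁  ≤⟨ *-monoˡ-≤-nonNeg a₁ {{nonNegative 0≤a₁}} (<⇒≤ b₁<b₂) ⟩
  a₁ * b₂  <⟨ *-monoʳ-<-pos b₂ {{positive (≤-<-trans 0≤b₁ b₁<b₂)}} a₁<a₂ ⟩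
  a₂ * b₂  ∎
  where open ≤-Reasoning

-- A positive multiple N · d of a positive integer N is at least N:
-- positivity forces d > 0, i.e. d ≥ 1.
positive-multiple-≥ : {N d : ℤ} → 0ℤ < N → 0ℤ < N * d → N ≤ N * d
positive-multiple-≥ {N} {d} 0<N 0<Nd = begin
  N       ≡⟨ sym (*-identityʳ N) ⟩
  N * 1ℤ  ≤⟨ *-monoˡ-≤-nonNeg N {{N≥0}} (i<j⇒suc[i]≤j 0<d) ⟩
  N * d   ∎
  where
  open ≤-Reasoning
  N≥0 : NonNegative N
  N≥0 = nonNegative (<⇒≤ 0<N)
  0<d : 0ℤ < d
  0<d = *-cancelˡ-<-nonNeg N {{N≥0}} (subst (_< N * d) (sym (*-zeroʳ N)) 0<Nd)

i<j⇒0<j-i : {i j : ℤ} → i < j → 0ℤ < j - i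
i<j⇒0<j-i {i} {j} i<j = begin-strict
  0ℤ     ≡⟨ sym (+-inverseʳ i) ⟩
  i - i  <⟨ +-monoˡ-< (- i) i<j ⟩
  j - i  ∎
  where open ≤-Reasoning

lemma1 : (n N a₁ a₂ b₁ b₂ : ℤ) → + 0 < n →
    n ≡ (N - a₁) * (N + b₁) → n ≡ (N - a₂) * (N + b₂) →
    + 0 ≤ a₁ → a₁ < a₂ → + 0 ≤ b₁ → b₁ < b₂ →
    N ≤ a₂ * b₂
lemma1 n N a₁ a₂ b₁ b₂ _ n≡p₁ n≡p₂ 0≤a₁ a₁<a₂ 0≤b₁ b₁<b₂ =
  ≤-trans N≤gap (i-j≤i (a₂ * b₂) (a₁ * b₁) {{nonNegative a₁b₁≥0}})
  where
  N*d≡gap : N * ((a₁ + b₂) - (a₂ + b₁)) ≡ a₂ * b₂ - a₁ * b₁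
  N*d≡gap = equal-products⇒linear N a₁ a₂ b₁ b₂ (trans (sym n≡p₁) n≡p₂)
  0<gap : 0ℤ < a₂ * b₂ - a₁ * b₁
  0<gap = i<j⇒0<j-i (*-strictMono-nonNeg 0≤a₁ a₁<a₂ 0≤b₁ b₁<b₂)
  a₁b₁≥0 : 0ℤ ≤ a₁ * b₁
  a₁b₁≥0 = subst (_≤ a₁ * b₁) (*-zeroʳ a₁) (*-monoˡ-≤-nonNeg a₁ {{nonNegative 0≤a₁}} 0≤b₁)
  N≤gap : N ≤ a₂ * b₂ - a₁ * b₁
  N≤gap with N ≤? 0ℤ
  ... | yes N≤0 = ≤-trans N≤0 (<⇒≤ 0<gap)
  ... | no  N≰0 = subst (N ≤_) N*d≡gap
                    (positive-multiple-≥ (≰⇒> N≰0) (subst (0ℤ <_) (sym N*d≡gap) 0<gap))
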